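{- Let $L\subseteq\{0,\dots,a-1\}$ and $n,k\ge0$. The number of $\sigma\in C_a\wr S_n$ with exactly $k$ right-to-left minima of $|\sigma|$ that are $L$-colored equals the number of $\sigma\in C_a\wr S_n$ with exactly $k$ cycles that are $L$-colored.
   Context: Let $\alpha=e^{2\pi i/a}$. Elements of $C_a\wr S_n$ are colored permutations $\sigma=[\sigma(1),\dots,\sigma(n)]$ with $\sigma(j)=\alpha^{t_j}|\sigma(j)|$, $0\le t_j\le a-1$, $|\sigma|=[|\sigma(1)|,\dots,|\sigma(n)|]\in S_n$. A right-to-left minimum $|\sigma(i)|$ of $|\sigma|$ (i.e. $|\sigma(i)|<|\sigma(j)|$ for all $j>i$) is $L$-colored if $t_i\in L$. For each cycle $\gamma$ of the permutation $|\sigma|$ (fixed points included), the color of $\gamma$ is $\prod_{j\in\gamma}\alpha^{t_j}\in C_a$ (the product of the colors of the entries $\sigma(j)$, $j$ in the cycle); the cycle is $L$-colored if its color is $\alpha^u$ for some $u\in L$. -}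

module Defs where

open import Data.Nat using (ℕ; zero; suc; _+_; _<_; _≤_; NonZero)
open import Data.Nat.DivMod using (_%_)
open import Data.Fin using (Fin; toℕ)
open import Data.Fin.Subset using (Subset; _∈_)
open import Data.Fin.Subset.Properties using (_∈?_)
open import Data.Fin.Properties using (any?; all?)
import Data.Fin.Properties as FinP
open import Data.Vec using (Vec; []; _∷_; lookup)
open import Data.Vec.Relation.Unary.Unique.Propositional using (Unique)
open import Data.List using (List; []; _∷_; length; filter; allFin; concatMap; map)
open import Data.Product using (Σ; _×_; _,_; proj₁; proj₂)
open import Relation.Nullary using (Dec; ¬_)
open import Relation.Nullary.Decidable using (_×-dec_; _→-dec_; ¬?)
open import Relation.Binary.PropositionalEquality using (_≡_)
import Data.Nat.Properties as ℕP
open import Data.Nat.ListAction using (sum)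

allVecs : (m n : ℕ) → List (Vec (Fin m) n)
allVecs m zero    = [] ∷ []
allVecs m (suc n) = concatMap (λ x → map (x ∷_) (allVecs m n)) (allFin m)

-- Raw data of a coloured permutation σ ∈ C_a ≀ S_n in one-line notation:
-- first component: |σ| = [|σ(1)|,…,|σ(n)|] (entries 0-indexed),
-- second component: the colour exponents t_1,…,t_n ∈ {0,…,a-1},
-- so that σ(j) = α^{t_j} |σ(j)|.
RawColPerm : ℕ → ℕ → Set
RawColPerm a n = Vec (Fin n) n × Vec (Fin a) n

IsPerm : ∀ {n} → Vec (Fin n) n → Set
IsPerm p = Unique p

isPerm? : ∀ {n} (p : Vec (Fin n) n) → Dec (IsPerm p)
isPerm? p = Data.Vec.Relation.Unary.AllPairs.allPairs? (λ x y → ¬? (x FinP.≟ y)) p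
  where import Data.Vec.Relation.Unary.AllPairs

colouredPerms : (a n : ℕ) → List (RawColPerm a n)
colouredPerms a n =
  filter (λ σ → isPerm? (proj₁ σ))
         (concatMap (λ p → map (p ,_) (allVecs a n)) (allVecs n n))

countColPerms : (a n : ℕ) {P : RawColPerm a n → Set} →
                ((σ : RawColPerm a n) → Dec (P σ)) → ℕ
countColPerms a n P? = length (filter P? (colouredPerms a n))

countFin : ∀ n {P : Fin n → Set} → ((i : Fin n) → Dec (P i)) → ℕ
countFin n P? = length (filter P? (allFin n))

IsRLMin : ∀ {n} → Vec (Fin n) n → Fin n → Set
IsRLMin {n} p i = (j : Fin n) → toℕ i < toℕ j → toℕ (lookup p i) < toℕ (lookup p j)

isRLMin? : ∀ {n} (p : Vec (Fin n) n) (i : Fin n) → Dec (IsRLMin p i)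
isRLMin? p i = all? λ j → (toℕ i ℕP.<? toℕ j) →-dec (toℕ (lookup p i) ℕP.<? toℕ (lookup p j))

lRLMin : ∀ {a n} → Subset a → RawColPerm a n → ℕ
lRLMin L (p , c) = countFin _ (λ i → isRLMin? p i ×-dec (lookup c i ∈? L))

iter : ∀ {n} → Vec (Fin n) n → ℕ → Fin n → Fin n
iter p zero    i = i
iter p (suc m) i = lookup p (iter p m i)

-- j lies in the cycle of |σ| containing i  (j = |σ|^m(i) for some m < n;
-- every cycle has length ≤ n).
InCycle : ∀ {n} → Vec (Fin n) n → Fin n → Fin n → Set
InCycle {n} p i j = Σ (Fin n) λ m → iter p (toℕ m) i ≡ j

inCycle? : ∀ {n} (p : Vec (Fin n) n) (i j : Fin n) → Dec (InCycle p i j)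
inCycle? p i j = any? λ m → iter p (toℕ m) i FinP.≟ j

-- i is the least element of its cycle: we count each cycle once via this
-- canonical representative.
IsCycleMin : ∀ {n} → Vec (Fin n) n → Fin n → Set
IsCycleMin {n} p i = (j : Fin n) → InCycle p i j → toℕ i ≤ toℕ j

isCycleMin? : ∀ {n} (p : Vec (Fin n) n) (i : Fin n) → Dec (IsCycleMin p i)
isCycleMin? p i = all? λ j → inCycle? p i j →-dec (toℕ i ℕP.≤? toℕ j)

sumOverCycle : ∀ {n} → Vec (Fin n) n → Fin n → (Fin n → ℕ) → ℕ
sumOverCycle {n} p i f = sum (map f (filter (inCycle? p i) (allFin n)))

-- Colour exponent of the cycle containing i: the colour is
-- ∏_{j ∈ γ} α^{t_j} = α^u with u = (Σ_{j∈γ} t_j) mod a.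
cycleColour : ∀ {a n} .{{_ : NonZero a}} → RawColPerm a n → Fin n → ℕ
cycleColour {a} (p , c) i = sumOverCycle p i (λ j → toℕ (lookup c j)) % a

_∈ℕ_ : ∀ {a} → ℕ → Subset a → Set
_∈ℕ_ {a} u L = Σ (Fin a) λ x → (toℕ x ≡ u) × (x ∈ L)

∈ℕ? : ∀ {a} (u : ℕ) (L : Subset a) → Dec (u ∈ℕ L)
∈ℕ? u L = any? λ x → (toℕ x ℕP.≟ u) ×-dec (x ∈? L)

lCycles : ∀ {a n} .{{_ : NonZero a}} → Subset a → RawColPerm a n → ℕ
lCycles L σ = countFin _ (λ i → isCycleMin? (proj₁ σ) i ×-dec ∈ℕ? (cycleColour σ i) L)

-- Both statistics satisfy the same recursion in n.  Split σ ∈ C_a ≀ S_{n+1}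
-- by its first entry x and its colour t: position 1 is an L-coloured
-- right-to-left minimum iff x = 1 and t ∈ L, and the other ones are those of
-- the coloured permutation of n letters that remains.  Alternatively, obtain σ
-- from a coloured permutation of n letters by inserting the letter n+1 just
-- before y = σ(n+1) in its cycle (as a fixed point if y = n+1) and shifting the
-- colour of the predecessor of y by the colour t of n+1: cycles, their minima
-- and their colours are preserved, apart from the new fixed point n+1 when
-- y = n+1, which is L-coloured iff t ∈ L.  Hence, for both statistics, the
-- number of σ with b + stat σ = k is the sum over x (resp. y) and t of the
-- same number for n letters with b increased by [x = x₀][t ∈ L], and this sum
-- does not depend on the distinguished letter x₀.

module Submission where

open import Defs
open import Data.Nat using (ℕ; zero; suc; _+_; _*_; _∸_; _≤_; _<_; z≤n; s≤s; NonZero)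
open import Data.Nat.Properties using (_≟_)
import Data.Nat.Properties as ℕP
open import Data.Nat.DivMod using (_%_; _mod_; m%n<n; m%n%n≡m%n; %-distribˡ-+; %-distribˡ-*; [m+n]%n≡m%n; m<n⇒m%n≡m)
open import Data.Nat.Induction using (<-rec)
import Data.Nat.ListAction as ListSum
open import Data.Nat.ListAction.Properties using (sum-++)
open import Data.Bool using (true; false; if_then_else_)
open import Data.Fin as Fin using (Fin; toℕ; fromℕ; fromℕ<; inject₁; punchIn; punchOut)
import Data.Fin.Properties as FinP
open import Data.Fin.Subset using (Subset; _∈_)
open import Data.Fin.Subset.Properties using (_∈?_)
open import Data.List as List using (List; []; _∷_; filter; concatMap; length; allFin)
import Data.List.Properties as ListP
open import Data.Vec as Vec using (Vec; []; _∷_; _∷ʳ_; lookup; tabulate)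
open import Data.Vec.Properties using (lookup-map; lookup∘tabulate; tabulate∘lookup; tabulate-∘; map-∘; map-cong)
open import Data.Vec.Relation.Unary.All as All using (All; []; _∷_; all?)
import Data.Vec.Relation.Unary.All.Properties as All
open import Data.Vec.Relation.Unary.AllPairs as AllPairs using ([]; _∷_)
open import Data.Vec.Relation.Unary.Unique.Propositional using (Unique)
import Data.Vec.Relation.Unary.Unique.Propositional.Properties as UniqueP
open import Data.Product using (∃; _×_; _,_; proj₁; proj₂)
open import Data.Sum using (_⊎_; inj₁; inj₂)
open import Data.Empty using (⊥; ⊥-elim)
open import Function using (_∘_; id; _⇔_; mk⇔; Equivalence)
open import Data.Product.Function.NonDependent.Propositional using (_×-⇔_)
open import Function.Construct.Identity using (⇔-id)
open import Relation.Nullary using (Dec; yes; no; does; ¬_)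
open import Relation.Nullary.Decidable using (_×-dec_; ¬?)
open import Relation.Binary.PropositionalEquality
open import Algebra.Properties.CommutativeMonoid.Sum ℕP.+-0-commutativeMonoid
  using (sum; sum-syntax; sum-cong-≗; sum-remove; sum-init-last; ∑-distrib-+; ∑-comm; sum-replicate-zero)
open import Algebra.Properties.Semiring.Sum ℕP.+-*-semiring using (*-distribˡ-sum; *-distribʳ-sum)

𝟙 : ∀ {p} {P : Set p} → Dec P → ℕ
𝟙 d = if does d then 1 else 0

module _ {p} {P : Set p} where

  𝟙-yes : (d : Dec P) → P → 𝟙 d ≡ 1
  𝟙-yes (yes _) _  = refl
  𝟙-yes (no ¬p) p = ⊥-elim (¬p p)

  𝟙-no : (d : Dec P) → ¬ P → 𝟙 d ≡ 0
  𝟙-no (yes p) ¬p = ⊥-elim (¬p p)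
  𝟙-no (no _)  _  = refl

module _ {p q} {P : Set p} {Q : Set q} where

  𝟙-cong : P ⇔ Q → (d : Dec P) (e : Dec Q) → 𝟙 d ≡ 𝟙 e
  𝟙-cong P⇔Q (yes p) e = sym (𝟙-yes e (Equivalence.to P⇔Q p))
  𝟙-cong P⇔Q (no ¬p) e = sym (𝟙-no e (¬p ∘ Equivalence.from P⇔Q))

  𝟙-× : (d : Dec P) (e : Dec Q) → 𝟙 (d ×-dec e) ≡ 𝟙 d * 𝟙 e
  𝟙-× (yes _) (yes _) = refl
  𝟙-× (yes _) (no _)  = refl
  𝟙-× (no _)  _       = refl

sum-zero : ∀ {n} {f : Fin n → ℕ} → (∀ i → f i ≡ 0) → sum f ≡ 0
sum-zero {n} f≡0 = trans (sum-cong-≗ f≡0) (sum-replicate-zero n)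

sum-reindex : ∀ n (π : Fin n → Fin n) → (∀ {i j} → π i ≡ π j → i ≡ j) →
              ∀ f → ∑[ i < n ] f (π i) ≡ sum f
sum-reindex zero    π π-inj f = refl
sum-reindex (suc n) π π-inj f = begin
  f (π Fin.zero) + ∑[ i < n ] f (π (Fin.suc i))
    ≡⟨ cong (f (π Fin.zero) +_) (sum-cong-≗ (λ i → cong f (sym (FinP.punchIn-punchOut (π0≢ i))))) ⟩
  f (π Fin.zero) + ∑[ i < n ] f (punchIn (π Fin.zero) (π′ i))
    ≡⟨ cong (f (π Fin.zero) +_) (sum-reindex n π′ π′-inj (f ∘ punchIn (π Fin.zero))) ⟩
  f (π Fin.zero) + ∑[ i < n ] f (punchIn (π Fin.zero) i)
    ≡⟨ sym (sum-remove {i = π Fin.zero} f) ⟩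
  sum f ∎
  where
  open ≡-Reasoning
  π0≢ : ∀ i → π Fin.zero ≢ π (Fin.suc i)
  π0≢ i eq with π-inj eq
  ... | ()
  π′ : Fin n → Fin n
  π′ i = punchOut (π0≢ i)
  π′-inj : ∀ {i j} → π′ i ≡ π′ j → i ≡ j
  π′-inj {i} {j} eq = FinP.suc-injective (π-inj (FinP.punchOut-injective (π0≢ i) (π0≢ j) eq))

∑𝟙-atMostOne : ∀ {n p} {P : Fin n → Set p} (P? : ∀ i → Dec (P i)) →
               (∀ {i j} → P i → P j → i ≡ j) → (∃P? : Dec (∃ P)) → ∑[ i < n ] 𝟙 (P? i) ≡ 𝟙 ∃P?
∑𝟙-atMostOne {zero} P? unique (yes (() , _))
∑𝟙-atMostOne {suc n} P? unique (yes (i , pᵢ)) = trans (sum-remove {i = i} (𝟙 ∘ P?))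
  (cong₂ _+_ (𝟙-yes (P? i) pᵢ) (sum-zero (λ j → 𝟙-no (P? (punchIn i j)) (λ pⱼ → FinP.punchInᵢ≢i i j (unique pⱼ pᵢ)))))
∑𝟙-atMostOne P? unique (no ∄) = sum-zero (λ i → 𝟙-no (P? i) (λ pᵢ → ∄ (i , pᵢ)))

∑-𝟙≟ : ∀ n (x₀ : Fin (suc n)) (ψ : ℕ → ℕ) →
       ∑[ x < suc n ] ψ (𝟙 (x FinP.≟ x₀)) ≡ ψ 1 + ∑[ _ < n ] ψ 0
∑-𝟙≟ n x₀ ψ = trans (sum-remove {i = x₀} (λ x → ψ (𝟙 (x FinP.≟ x₀))))
  (cong₂ _+_ (cong ψ (𝟙-yes (x₀ FinP.≟ x₀) refl))
             (sum-cong-≗ (λ i → cong ψ (𝟙-no (punchIn x₀ i FinP.≟ x₀) (FinP.punchInᵢ≢i x₀ i)))))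

sumOver : ∀ {a} {A : Set a} → List A → (A → ℕ) → ℕ
sumOver xs f = ListSum.sum (List.map f xs)

module _ {a} {A : Set a} where

  sumOver-cong : ∀ xs {f g : A → ℕ} → (∀ x → f x ≡ g x) → sumOver xs f ≡ sumOver xs g
  sumOver-cong xs f≗g = cong ListSum.sum (ListP.map-cong f≗g xs)

  sumOver-*ˡ : ∀ xs k (f : A → ℕ) → sumOver xs (λ x → k * f x) ≡ k * sumOver xs f
  sumOver-*ˡ []       k f = sym (ℕP.*-zeroʳ k)
  sumOver-*ˡ (x ∷ xs) k f = trans (cong (k * f x +_) (sumOver-*ˡ xs k f)) (sym (ℕP.*-distribˡ-+ k (f x) _))

  length-filter≡∑𝟙 : ∀ {p} {P : A → Set p} (P? : ∀ x → Dec (P x)) xs →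
                     length (filter P? xs) ≡ sumOver xs (𝟙 ∘ P?)
  length-filter≡∑𝟙 P? []       = refl
  length-filter≡∑𝟙 P? (x ∷ xs) with does (P? x)
  ... | true  = cong suc (length-filter≡∑𝟙 P? xs)
  ... | false = length-filter≡∑𝟙 P? xs

  sumOver-filter : ∀ {p} {P : A → Set p} (P? : ∀ x → Dec (P x)) xs f →
                   sumOver (filter P? xs) f ≡ sumOver xs (λ x → 𝟙 (P? x) * f x)
  sumOver-filter P? []       f = refl
  sumOver-filter P? (x ∷ xs) f with does (P? x)
  ... | true  = cong₂ _+_ (sym (ℕP.*-identityˡ (f x))) (sumOver-filter P? xs f)
  ... | false = sumOver-filter P? xs f

  sumOver-tabulate : ∀ {n} (g : Fin n → A) f → sumOver (List.tabulate g) f ≡ ∑[ i < n ] f (g i)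
  sumOver-tabulate {zero}  g f = refl
  sumOver-tabulate {suc n} g f = cong (f (g Fin.zero) +_) (sumOver-tabulate (g ∘ Fin.suc) f)

sumOver-allFin : ∀ n f → sumOver (allFin n) f ≡ sum f
sumOver-allFin n f = sumOver-tabulate id f

countFin≡∑𝟙 : ∀ n {P : Fin n → Set} (P? : ∀ i → Dec (P i)) → countFin n P? ≡ ∑[ i < n ] 𝟙 (P? i)
countFin≡∑𝟙 n P? = trans (length-filter≡∑𝟙 P? (allFin n)) (sumOver-allFin n (𝟙 ∘ P?))

module _ {a b} {A : Set a} {B : Set b} where

  sumOver-map : ∀ (g : A → B) xs f → sumOver (List.map g xs) f ≡ sumOver xs (f ∘ g)
  sumOver-map g xs f = cong ListSum.sum (sym (ListP.map-∘ xs))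

  sumOver-concatMap : ∀ (g : A → List B) xs f →
                      sumOver (concatMap g xs) f ≡ sumOver xs (λ x → sumOver (g x) f)
  sumOver-concatMap g []       f = refl
  sumOver-concatMap g (x ∷ xs) f = begin
    ListSum.sum (List.map f (g x List.++ concatMap g xs))
      ≡⟨ cong ListSum.sum (ListP.map-++ f (g x) _) ⟩
    ListSum.sum (List.map f (g x) List.++ List.map f (concatMap g xs))
      ≡⟨ sum-++ (List.map f (g x)) _ ⟩
    sumOver (g x) f + sumOver (concatMap g xs) f
      ≡⟨ cong (sumOver (g x) f +_) (sumOver-concatMap g xs f) ⟩
    sumOver (g x) f + sumOver xs (λ x → sumOver (g x) f) ∎
    where open ≡-Reasoning

∑ᵛ : ∀ m l → (Vec (Fin m) l → ℕ) → ℕ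
∑ᵛ m zero    f = f []
∑ᵛ m (suc l) f = ∑[ x < m ] ∑ᵛ m l (λ v → f (x ∷ v))

sumOver-allVecs : ∀ m l f → sumOver (allVecs m l) f ≡ ∑ᵛ m l f
sumOver-allVecs m zero    f = ℕP.+-identityʳ (f [])
sumOver-allVecs m (suc l) f = begin
  sumOver (concatMap (λ x → List.map (x ∷_) (allVecs m l)) (allFin m)) f
    ≡⟨ sumOver-concatMap _ (allFin m) f ⟩
  sumOver (allFin m) (λ x → sumOver (List.map (x ∷_) (allVecs m l)) f)
    ≡⟨ sumOver-allFin m _ ⟩
  ∑[ x < m ] sumOver (List.map (x ∷_) (allVecs m l)) f
    ≡⟨ sum-cong-≗ (λ x → sumOver-map (x ∷_) (allVecs m l) f) ⟩
  ∑[ x < m ] sumOver (allVecs m l) (λ v → f (x ∷ v))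
    ≡⟨ sum-cong-≗ (λ x → sumOver-allVecs m l (λ v → f (x ∷ v))) ⟩
  ∑ᵛ m (suc l) f ∎
  where open ≡-Reasoning

∑ᵛ-cong : ∀ m l {f g : Vec (Fin m) l → ℕ} → (∀ v → f v ≡ g v) → ∑ᵛ m l f ≡ ∑ᵛ m l g
∑ᵛ-cong m zero    f≗g = f≗g []
∑ᵛ-cong m (suc l) f≗g = sum-cong-≗ (λ x → ∑ᵛ-cong m l (λ v → f≗g (x ∷ v)))

∑ᵛ-*ˡ : ∀ m l k f → ∑ᵛ m l (λ v → k * f v) ≡ k * ∑ᵛ m l f
∑ᵛ-*ˡ m zero    k f = refl
∑ᵛ-*ˡ m (suc l) k f = trans (sum-cong-≗ (λ x → ∑ᵛ-*ˡ m l k (λ v → f (x ∷ v))))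
                            (sym (*-distribˡ-sum k (λ x → ∑ᵛ m l (λ v → f (x ∷ v)))))

∑ᵛ-∑-comm : ∀ m l k (g : Vec (Fin m) l → Fin k → ℕ) →
            ∑ᵛ m l (λ v → ∑[ x < k ] g v x) ≡ ∑[ x < k ] ∑ᵛ m l (λ v → g v x)
∑ᵛ-∑-comm m zero    k g = refl
∑ᵛ-∑-comm m (suc l) k g = trans (sum-cong-≗ (λ y → ∑ᵛ-∑-comm m l k (λ v → g (y ∷ v))))
                                (∑-comm (λ y x → ∑ᵛ m l (λ v → g (y ∷ v) x)))

∑ᵛ-∷ʳ : ∀ m l f → ∑ᵛ m (suc l) f ≡ ∑ᵛ m l (λ v → ∑[ x < m ] f (v ∷ʳ x))
∑ᵛ-∷ʳ m zero    f = refl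
∑ᵛ-∷ʳ m (suc l) f = sum-cong-≗ (λ x → ∑ᵛ-∷ʳ m l (λ v → f (x ∷ v)))

mapAt : ∀ {a} {A : Set a} {l} → (Fin l → A → A) → Vec A l → Vec A l
mapAt g v = tabulate (λ i → g i (lookup v i))

∑ᵛ-reindex : ∀ m l (g : Fin l → Fin m → Fin m) → (∀ i {x y} → g i x ≡ g i y → x ≡ y) →
             ∀ f → ∑ᵛ m l (λ v → f (mapAt g v)) ≡ ∑ᵛ m l f
∑ᵛ-reindex m zero    g g-inj f = refl
∑ᵛ-reindex m (suc l) g g-inj f =
  trans (sum-cong-≗ (λ x → ∑ᵛ-reindex m l (g ∘ Fin.suc) (g-inj ∘ Fin.suc) (λ w → f (g Fin.zero x ∷ w))))
        (sum-reindex m (g Fin.zero) (g-inj Fin.zero) _)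

∑ᵛ-reindex-map : ∀ m l (σ : Fin m → Fin m) → (∀ {x y} → σ x ≡ σ y → x ≡ y) →
                 ∀ f → ∑ᵛ m l (λ v → f (Vec.map σ v)) ≡ ∑ᵛ m l f
∑ᵛ-reindex-map m l σ σ-inj f =
  trans (∑ᵛ-cong m l (λ v → cong f (map-as-mapAt v))) (∑ᵛ-reindex m l (λ _ → σ) (λ _ → σ-inj) f)
  where
  map-as-mapAt : ∀ v → Vec.map σ v ≡ mapAt (λ _ → σ) v
  map-as-mapAt v = trans (cong (Vec.map σ) (sym (tabulate∘lookup v))) (sym (tabulate-∘ σ (lookup v)))

avoids? : ∀ {m l} (x : Fin m) (v : Vec (Fin m) l) → Dec (All (x ≢_) v)
avoids? x = all? (λ y → ¬? (x FinP.≟ y))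

∑ᵛ-avoiding : ∀ m l (x : Fin (suc m)) f →
              ∑ᵛ (suc m) l (λ v → 𝟙 (avoids? x v) * f v) ≡ ∑ᵛ m l (λ w → f (Vec.map (punchIn x) w))
∑ᵛ-avoiding m zero    x f = ℕP.*-identityˡ (f [])
∑ᵛ-avoiding m (suc l) x f = begin
  ∑[ y < suc m ] ∑ᵛ (suc m) l (λ v → 𝟙 (avoids? x (y ∷ v)) * f (y ∷ v))
    ≡⟨ sum-cong-≗ factor ⟩
  ∑[ y < suc m ] (𝟙 (x≢? y) * rest y)
    ≡⟨ sum-remove {i = x} (λ y → 𝟙 (x≢? y) * rest y) ⟩
  𝟙 (x≢? x) * rest x + ∑[ z < m ] (𝟙 (x≢? (punchIn x z)) * rest (punchIn x z))
    ≡⟨ cong₂ _+_ (cong (_* rest x) (𝟙-no (x≢? x) (λ x≢x → x≢x refl)))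
                 (sum-cong-≗ (λ z → trans (cong (_* rest (punchIn x z)) (𝟙-yes (x≢? (punchIn x z)) (FinP.punchInᵢ≢i x z ∘ sym)))
                                          (ℕP.*-identityˡ _))) ⟩
  ∑[ z < m ] rest (punchIn x z)
    ≡⟨ sum-cong-≗ (λ z → ∑ᵛ-avoiding m l x (λ v → f (punchIn x z ∷ v))) ⟩
  ∑ᵛ m (suc l) (λ w → f (Vec.map (punchIn x) w)) ∎
  where
  open ≡-Reasoning
  x≢? : ∀ y → Dec (x ≢ y)
  x≢? y = ¬? (x FinP.≟ y)
  rest : Fin (suc m) → ℕ
  rest y = ∑ᵛ (suc m) l (λ v → 𝟙 (avoids? x v) * f (y ∷ v))
  factor : ∀ y → ∑ᵛ (suc m) l (λ v → 𝟙 (avoids? x (y ∷ v)) * f (y ∷ v)) ≡ 𝟙 (x≢? y) * rest y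
  factor y = trans (∑ᵛ-cong (suc m) l (λ v → trans (cong (_* f (y ∷ v)) (𝟙-× (x≢? y) (avoids? x v)))
                                                  (ℕP.*-assoc (𝟙 (x≢? y)) _ _)))
                   (∑ᵛ-*ˡ (suc m) l (𝟙 (x≢? y)) (λ v → 𝟙 (avoids? x v) * f (y ∷ v)))

-- isPerm? is unique?, and unique? (x ∷ v) computes to avoids? x v ×-dec unique? v.
unique? : ∀ {m l} (v : Vec (Fin m) l) → Dec (Unique v)
unique? = AllPairs.allPairs? (λ x y → ¬? (x FinP.≟ y))

module _ {a} {A : Set a} where

  All-∷ʳ⁺ : ∀ {p} {P : A → Set p} {l} {v : Vec A l} {y} → All P v → P y → All P (v ∷ʳ y)
  All-∷ʳ⁺ []         py = py ∷ []
  All-∷ʳ⁺ (px ∷ pxs) py = px ∷ All-∷ʳ⁺ pxs py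

  All-∷ʳ⁻ : ∀ {p} {P : A → Set p} {l} {v : Vec A l} {y} → All P (v ∷ʳ y) → All P v × P y
  All-∷ʳ⁻ {v = []}    (py ∷ [])  = [] , py
  All-∷ʳ⁻ {v = _ ∷ _} (px ∷ pxs) = let pv , py = All-∷ʳ⁻ pxs in px ∷ pv , py

  unique-∷ʳ⁺ : ∀ {l} {v : Vec A l} {y} → All (y ≢_) v → Unique v → Unique (v ∷ʳ y)
  unique-∷ʳ⁺ []             []         = [] ∷ []
  unique-∷ʳ⁺ (y≢x ∷ y∉v) (x∉v ∷ uv) = All-∷ʳ⁺ x∉v (y≢x ∘ sym) ∷ unique-∷ʳ⁺ y∉v uv

  unique-∷ʳ⁻ : ∀ {l} {v : Vec A l} {y} → Unique (v ∷ʳ y) → All (y ≢_) v × Unique v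
  unique-∷ʳ⁻ {v = []}    _            = [] , []
  unique-∷ʳ⁻ {v = _ ∷ _} (x∉vy ∷ uvy) =
    let x∉v , x≢y = All-∷ʳ⁻ x∉vy ; y∉v , uv = unique-∷ʳ⁻ uvy in (x≢y ∘ sym) ∷ y∉v , x∉v ∷ uv

  unique-map⁻ : ∀ {b} {B : Set b} (f : A → B) {l} {v : Vec A l} → Unique (Vec.map f v) → Unique v
  unique-map⁻ f {v = []}    []          = []
  unique-map⁻ f {v = _ ∷ _} (fx∉ ∷ ufv) =
    All.map (λ fx≢fy → fx≢fy ∘ cong f) (All.map⁻ fx∉) ∷ unique-map⁻ f ufv

𝟙-unique-map : ∀ {m k l} (f : Fin m → Fin k) → (∀ {x y} → f x ≡ f y → x ≡ y) → (v : Vec (Fin m) l) →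
               𝟙 (unique? (Vec.map f v)) ≡ 𝟙 (unique? v)
𝟙-unique-map f f-inj v = 𝟙-cong (mk⇔ (unique-map⁻ f) (UniqueP.map⁺ f-inj)) (unique? (Vec.map f v)) (unique? v)

permSum : ∀ n → (Vec (Fin n) n → ℕ) → ℕ
permSum n F = ∑ᵛ n n (λ p → 𝟙 (isPerm? p) * F p)

countColPerms≡permSum : ∀ a n {P : RawColPerm a n → Set} (P? : ∀ σ → Dec (P σ)) →
                        countColPerms a n P? ≡ permSum n (λ p → ∑ᵛ a n (λ c → 𝟙 (P? (p , c))))
countColPerms≡permSum a n P? = begin
  length (filter P? (filter (isPerm? ∘ proj₁) pairs))
    ≡⟨ length-filter≡∑𝟙 P? (filter (isPerm? ∘ proj₁) pairs) ⟩
  sumOver (filter (isPerm? ∘ proj₁) pairs) (𝟙 ∘ P?)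
    ≡⟨ sumOver-filter (isPerm? ∘ proj₁) pairs (𝟙 ∘ P?) ⟩
  sumOver pairs (λ σ → 𝟙 (isPerm? (proj₁ σ)) * 𝟙 (P? σ))
    ≡⟨ sumOver-concatMap (λ p → List.map (p ,_) (allVecs a n)) (allVecs n n) _ ⟩
  sumOver (allVecs n n) (λ p → sumOver (List.map (p ,_) (allVecs a n)) (λ σ → 𝟙 (isPerm? (proj₁ σ)) * 𝟙 (P? σ)))
    ≡⟨ sumOver-cong (allVecs n n) (λ p → trans (sumOver-map (p ,_) (allVecs a n) _) (sumOver-*ˡ (allVecs a n) (𝟙 (isPerm? p)) _)) ⟩
  sumOver (allVecs n n) (λ p → 𝟙 (isPerm? p) * sumOver (allVecs a n) (λ c → 𝟙 (P? (p , c))))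
    ≡⟨ sumOver-cong (allVecs n n) (λ p → cong (𝟙 (isPerm? p) *_) (sumOver-allVecs a n (λ c → 𝟙 (P? (p , c))))) ⟩
  sumOver (allVecs n n) (λ p → 𝟙 (isPerm? p) * ∑ᵛ a n (λ c → 𝟙 (P? (p , c))))
    ≡⟨ sumOver-allVecs n n _ ⟩
  permSum n (λ p → ∑ᵛ a n (λ c → 𝟙 (P? (p , c)))) ∎
  where
  open ≡-Reasoning
  pairs : List (RawColPerm a n)
  pairs = concatMap (λ p → List.map (p ,_) (allVecs a n)) (allVecs n n)

permSum-cong : ∀ n {F G : Vec (Fin n) n → ℕ} → (∀ p → IsPerm p → F p ≡ G p) → permSum n F ≡ permSum n G
permSum-cong n {F} {G} F≡G = ∑ᵛ-cong n n restrict
  where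
  restrict : ∀ p → 𝟙 (isPerm? p) * F p ≡ 𝟙 (isPerm? p) * G p
  restrict p with isPerm? p
  ... | yes perm = cong (1 *_) (F≡G p perm)
  ... | no _     = refl

permSum-∑-comm : ∀ n k (h : Vec (Fin n) n → Fin k → ℕ) →
                 permSum n (λ p → ∑[ x < k ] h p x) ≡ ∑[ x < k ] permSum n (λ p → h p x)
permSum-∑-comm n k h = trans (∑ᵛ-cong n n (λ p → *-distribˡ-sum (𝟙 (isPerm? p)) (h p)))
                             (∑ᵛ-∑-comm n n k (λ p x → 𝟙 (isPerm? p) * h p x))

prepend : ∀ {n} → Fin (suc n) → Vec (Fin n) n → Vec (Fin (suc n)) (suc n)
prepend x p = x ∷ Vec.map (punchIn x) p

permSum-prepend : ∀ n F → permSum (suc n) F ≡ ∑[ x < suc n ] permSum n (F ∘ prepend x)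
permSum-prepend n F = sum-cong-≗ λ x → begin
  ∑ᵛ (suc n) n (λ v → 𝟙 (isPerm? (x ∷ v)) * F (x ∷ v))
    ≡⟨ ∑ᵛ-cong (suc n) n (λ v → trans (cong (_* F (x ∷ v)) (𝟙-× (avoids? x v) (unique? v))) (ℕP.*-assoc (𝟙 (avoids? x v)) _ _)) ⟩
  ∑ᵛ (suc n) n (λ v → 𝟙 (avoids? x v) * (𝟙 (unique? v) * F (x ∷ v)))
    ≡⟨ ∑ᵛ-avoiding n n x (λ v → 𝟙 (unique? v) * F (x ∷ v)) ⟩
  ∑ᵛ n n (λ w → 𝟙 (unique? (Vec.map (punchIn x) w)) * F (prepend x w))
    ≡⟨ ∑ᵛ-cong n n (λ w → cong (_* F (prepend x w)) (𝟙-unique-map (punchIn x) (FinP.punchIn-injective x _ _) w)) ⟩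
  permSum n (F ∘ prepend x) ∎
  where open ≡-Reasoning

redirect : ∀ {n} → Fin (suc n) → Fin n → Fin (suc n)
redirect {n} y u with inject₁ u FinP.≟ y
... | yes _ = fromℕ n
... | no  _ = inject₁ u

redirect-≢ : ∀ {n} (y : Fin (suc n)) (u : Fin n) → y ≢ redirect y u
redirect-≢ y u with inject₁ u FinP.≟ y
... | yes u≡y = λ y≡n → FinP.fromℕ≢inject₁ (sym (trans u≡y y≡n))
... | no  u≢y = u≢y ∘ sym

redirect-injective : ∀ {n} (y : Fin (suc n)) {u v : Fin n} → redirect y u ≡ redirect y v → u ≡ v
redirect-injective y {u} {v} eq with inject₁ u FinP.≟ y | inject₁ v FinP.≟ y
... | yes u≡y | yes v≡y = FinP.inject₁-injective (trans u≡y (sym v≡y))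
... | yes _   | no  _   = ⊥-elim (FinP.fromℕ≢inject₁ eq)
... | no  _   | yes _   = ⊥-elim (FinP.fromℕ≢inject₁ (sym eq))
... | no  _   | no  _   = FinP.inject₁-injective eq

redirect-into : ∀ {n} {y : Fin (suc n)} {u : Fin n} → inject₁ u ≡ y → redirect y u ≡ fromℕ n
redirect-into {y = y} {u} u≡y with inject₁ u FinP.≟ y
... | yes _   = refl
... | no  u≢y = ⊥-elim (u≢y u≡y)

redirect-past : ∀ {n} {y : Fin (suc n)} {u : Fin n} → inject₁ u ≢ y → redirect y u ≡ inject₁ u
redirect-past {y = y} {u} u≢y with inject₁ u FinP.≟ y
... | yes u≡y = ⊥-elim (u≢y u≡y)
... | no  _   = refl

redirect≡fromℕ⇒ : ∀ {n} {y : Fin (suc n)} {u : Fin n} → redirect y u ≡ fromℕ n → inject₁ u ≡ y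
redirect≡fromℕ⇒ {y = y} {u} eq with inject₁ u FinP.≟ y
... | yes u≡y = u≡y
... | no  _   = ⊥-elim (FinP.fromℕ≢inject₁ (sym eq))

redirect≡inject₁⇒ : ∀ {n} {y : Fin (suc n)} {u v : Fin n} → redirect y u ≡ inject₁ v → u ≡ v
redirect≡inject₁⇒ {y = y} {u} eq with inject₁ u FinP.≟ y
... | yes _ = ⊥-elim (FinP.fromℕ≢inject₁ eq)
... | no  _ = FinP.inject₁-injective eq

-- insertLast y p inserts the new point n into the cycle of p just before y,
-- or as a fixed point when y = n.
insertLast : ∀ {n} → Fin (suc n) → Vec (Fin n) n → Vec (Fin (suc n)) (suc n)
insertLast y p = Vec.map (redirect y) p ∷ʳ y

permSum-insertLast : ∀ n F → permSum (suc n) F ≡ ∑[ y < suc n ] permSum n (F ∘ insertLast y)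
permSum-insertLast n F =
  trans (∑ᵛ-∷ʳ (suc n) n (λ p → 𝟙 (isPerm? p) * F p))
  (trans (∑ᵛ-∑-comm (suc n) n (suc n) (λ v y → 𝟙 (isPerm? (v ∷ʳ y)) * F (v ∷ʳ y)))
         (sum-cong-≗ fixLast))
  where
  open ≡-Reasoning
  fixLast : ∀ y → ∑ᵛ (suc n) n (λ v → 𝟙 (isPerm? (v ∷ʳ y)) * F (v ∷ʳ y)) ≡ permSum n (F ∘ insertLast y)
  fixLast y = begin
    ∑ᵛ (suc n) n (λ v → 𝟙 (isPerm? (v ∷ʳ y)) * F (v ∷ʳ y))
      ≡⟨ ∑ᵛ-cong (suc n) n (λ v → trans (cong (_* F (v ∷ʳ y)) (split v)) (ℕP.*-assoc (𝟙 (avoids? y v)) _ _)) ⟩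
    ∑ᵛ (suc n) n (λ v → 𝟙 (avoids? y v) * (𝟙 (unique? v) * F (v ∷ʳ y)))
      ≡⟨ ∑ᵛ-avoiding n n y (λ v → 𝟙 (unique? v) * F (v ∷ʳ y)) ⟩
    ∑ᵛ n n (λ w → 𝟙 (unique? (Vec.map (punchIn y) w)) * F (Vec.map (punchIn y) w ∷ʳ y))
      ≡⟨ ∑ᵛ-cong n n (λ w → cong (_* F (Vec.map (punchIn y) w ∷ʳ y)) (𝟙-unique-map (punchIn y) (FinP.punchIn-injective y _ _) w)) ⟩
    ∑ᵛ n n (λ w → 𝟙 (unique? w) * F (Vec.map (punchIn y) w ∷ʳ y))
      ≡⟨ sym (∑ᵛ-reindex-map n n σ σ-injective (λ w → 𝟙 (unique? w) * F (Vec.map (punchIn y) w ∷ʳ y))) ⟩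
    ∑ᵛ n n (λ p → 𝟙 (unique? (Vec.map σ p)) * F (Vec.map (punchIn y) (Vec.map σ p) ∷ʳ y))
      ≡⟨ ∑ᵛ-cong n n (λ p → cong₂ _*_ (𝟙-unique-map σ σ-injective p) (cong (λ w → F (w ∷ʳ y)) (punchIn∘σ p))) ⟩
    permSum n (F ∘ insertLast y) ∎
    where
    split : ∀ v → 𝟙 (isPerm? (v ∷ʳ y)) ≡ 𝟙 (avoids? y v) * 𝟙 (unique? v)
    split v = trans (𝟙-cong (mk⇔ unique-∷ʳ⁻ (λ (y∉v , uv) → unique-∷ʳ⁺ y∉v uv)) (isPerm? (v ∷ʳ y)) (avoids? y v ×-dec unique? v))
                    (𝟙-× (avoids? y v) (unique? v))
    σ : Fin n → Fin n
    σ u = punchOut (redirect-≢ y u)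
    σ-injective : ∀ {u v} → σ u ≡ σ v → u ≡ v
    σ-injective {u} {v} eq = redirect-injective y (FinP.punchOut-injective (redirect-≢ y u) (redirect-≢ y v) eq)
    punchIn∘σ : ∀ p → Vec.map (punchIn y) (Vec.map σ p) ≡ Vec.map (redirect y) p
    punchIn∘σ p = trans (sym (map-∘ (punchIn y) σ p)) (map-cong (λ u → FinP.punchIn-punchOut (redirect-≢ y u)) p)

Reach : ∀ {n} → Vec (Fin n) n → Fin n → Fin n → Set
Reach p i j = ∃ λ m → iter p m i ≡ j

module _ {n} (p : Vec (Fin n) n) where

  iter-+ : ∀ m k i → iter p (m + k) i ≡ iter p m (iter p k i)
  iter-+ zero    k i = refl
  iter-+ (suc m) k i = cong (lookup p) (iter-+ m k i)

  reach-refl : ∀ {i} → Reach p i i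
  reach-refl = 0 , refl

  reach-trans : ∀ {i j k} → Reach p i j → Reach p j k → Reach p i k
  reach-trans {i} (m , refl) (k , refl) = k + m , iter-+ k m i

  inCycle⇒reach : ∀ {i j} → InCycle p i j → Reach p i j
  inCycle⇒reach (m , eq) = toℕ m , eq

  -- Among the n + 1 points iter p k i with k ≤ n two coincide, so the orbit
  -- repeats and any m ≥ n can be shortened.
  iter-shorten : ∀ {m} i → n ≤ m → ∃ λ m′ → m′ < m × iter p m′ i ≡ iter p m i
  iter-shorten {m} i n≤m with FinP.pigeonhole (ℕP.n<1+n n) (λ k → iter p (toℕ k) i)
  ... | k₁ , k₂ , k₁<k₂ , same = m ∸ toℕ k₂ + toℕ k₁ , shorter , sameEnd
    where
    k₂≤m : toℕ k₂ ≤ m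
    k₂≤m = ℕP.≤-trans (ℕP.<⇒≤pred (FinP.toℕ<n k₂)) n≤m
    shorter : m ∸ toℕ k₂ + toℕ k₁ < m
    shorter = subst (m ∸ toℕ k₂ + toℕ k₁ <_) (ℕP.m∸n+n≡m k₂≤m) (ℕP.+-monoʳ-< (m ∸ toℕ k₂) k₁<k₂)
    sameEnd : iter p (m ∸ toℕ k₂ + toℕ k₁) i ≡ iter p m i
    sameEnd = begin
      iter p (m ∸ toℕ k₂ + toℕ k₁) i       ≡⟨ iter-+ (m ∸ toℕ k₂) (toℕ k₁) i ⟩
      iter p (m ∸ toℕ k₂) (iter p (toℕ k₁) i) ≡⟨ cong (iter p (m ∸ toℕ k₂)) same ⟩
      iter p (m ∸ toℕ k₂) (iter p (toℕ k₂) i) ≡⟨ iter-+ (m ∸ toℕ k₂) (toℕ k₂) i ⟨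
      iter p (m ∸ toℕ k₂ + toℕ k₂) i       ≡⟨ cong (λ k → iter p k i) (ℕP.m∸n+n≡m k₂≤m) ⟩
      iter p m i                           ∎
      where open ≡-Reasoning

  reach⇒inCycle : ∀ {i j} → Reach p i j → InCycle p i j
  reach⇒inCycle {i} {j} (m , eq) = <-rec (λ m → iter p m i ≡ j → InCycle p i j) shortest m eq
    where
    shortest : ∀ m → (∀ {m′} → m′ < m → iter p m′ i ≡ j → InCycle p i j) → iter p m i ≡ j → InCycle p i j
    shortest m shorter eq with m ℕP.<? n
    ... | yes m<n = fromℕ< m<n , trans (cong (λ k → iter p k i) (FinP.toℕ-fromℕ< m<n)) eq
    ... | no  m≮n = let m′ , m′<m , same = iter-shorten i (ℕP.≮⇒≥ m≮n) in shorter m′<m (trans same eq)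

inject₁⊎fromℕ : ∀ {n} (z : Fin (suc n)) → (∃ λ u → z ≡ inject₁ u) ⊎ z ≡ fromℕ n
inject₁⊎fromℕ {zero}  Fin.zero    = inj₂ refl
inject₁⊎fromℕ {suc n} Fin.zero    = inj₁ (Fin.zero , refl)
inject₁⊎fromℕ {suc n} (Fin.suc z) with inject₁⊎fromℕ z
... | inj₁ (u , refl) = inj₁ (Fin.suc u , refl)
... | inj₂ refl       = inj₂ refl

module _ {a} {A : Set a} where

  lookup-∷ʳ-inject₁ : ∀ {n} (v : Vec A n) z i → lookup (v ∷ʳ z) (inject₁ i) ≡ lookup v i
  lookup-∷ʳ-inject₁ (x ∷ v) z Fin.zero    = refl
  lookup-∷ʳ-inject₁ (x ∷ v) z (Fin.suc i) = lookup-∷ʳ-inject₁ v z i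

  lookup-∷ʳ-fromℕ : ∀ {n} (v : Vec A n) z → lookup (v ∷ʳ z) (fromℕ n) ≡ z
  lookup-∷ʳ-fromℕ []      z = refl
  lookup-∷ʳ-fromℕ (x ∷ v) z = lookup-∷ʳ-fromℕ v z

module CyclesOfInsertLast {n} (p : Vec (Fin n) n) (y : Fin (suc n)) where

  p⁺ : Vec (Fin (suc n)) (suc n)
  p⁺ = insertLast y p

  PrecedesY : Fin n → Set
  PrecedesY u = inject₁ (lookup p u) ≡ y

  p⁺-inject₁ : ∀ u → lookup p⁺ (inject₁ u) ≡ redirect y (lookup p u)
  p⁺-inject₁ u = trans (lookup-∷ʳ-inject₁ (Vec.map (redirect y) p) y u) (lookup-map u (redirect y) p)

  p⁺-fromℕ : lookup p⁺ (fromℕ n) ≡ y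
  p⁺-fromℕ = lookup-∷ʳ-fromℕ (Vec.map (redirect y) p) y

  orbit-inject₁ : ∀ m i → (∀ j → iter p⁺ m (inject₁ i) ≡ inject₁ j → Reach p i j)
                        × (iter p⁺ m (inject₁ i) ≡ fromℕ n → ∃ λ u → Reach p i u × PrecedesY u)
  orbit-inject₁ zero    i = (λ j eq → 0 , FinP.inject₁-injective eq) , (λ eq → ⊥-elim (FinP.fromℕ≢inject₁ (sym eq)))
  orbit-inject₁ (suc m) i with inject₁⊎fromℕ (iter p⁺ m (inject₁ i)) | orbit-inject₁ m i
  ... | inj₁ (u , atU) | toOld , _ =
        (λ j eq → reach-trans p (toOld u atU) (1 , redirect≡inject₁⇒ (afterU eq)))
      , (λ eq → u , toOld u atU , redirect≡fromℕ⇒ (afterU eq))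
    where
    afterU : ∀ {z} → lookup p⁺ (iter p⁺ m (inject₁ i)) ≡ z → redirect y (lookup p u) ≡ z
    afterU eq = trans (sym (p⁺-inject₁ u)) (trans (cong (lookup p⁺) (sym atU)) eq)
  ... | inj₂ atN | _ , toNew =
        (λ j eq → let u , i↝u , u↦y = toNew atN in
                  reach-trans p i↝u (1 , FinP.inject₁-injective (trans u↦y (afterN eq))))
      , (λ _ → toNew atN)
    where
    afterN : ∀ {z} → lookup p⁺ (iter p⁺ m (inject₁ i)) ≡ z → y ≡ z
    afterN eq = trans (sym p⁺-fromℕ) (trans (cong (lookup p⁺) (sym atN)) eq)

  reach⁺-step : ∀ u → Reach p⁺ (inject₁ u) (inject₁ (lookup p u))
  reach⁺-step u with inject₁ (lookup p u) FinP.≟ y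
  ... | yes u↦y = 2 , trans (cong (lookup p⁺) (trans (p⁺-inject₁ u) (redirect-into u↦y))) (trans p⁺-fromℕ (sym u↦y))
  ... | no  u↦̸y = 1 , trans (p⁺-inject₁ u) (redirect-past u↦̸y)

  reach⁺-inject₁ : ∀ {i j} → Reach p i j → Reach p⁺ (inject₁ i) (inject₁ j)
  reach⁺-inject₁ (zero  , refl) = reach-refl p⁺
  reach⁺-inject₁ (suc m , refl) = reach-trans p⁺ (reach⁺-inject₁ (m , refl)) (reach⁺-step (iter p m _))

  inCycle⁺-inject₁ : ∀ i j → InCycle p⁺ (inject₁ i) (inject₁ j) ⇔ InCycle p i j
  inCycle⁺-inject₁ i j = mk⇔
    (λ (m , eq) → reach⇒inCycle p (proj₁ (orbit-inject₁ (toℕ m) i) j eq))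
    (reach⇒inCycle p⁺ ∘ reach⁺-inject₁ ∘ inCycle⇒reach p)

  inCycle⁺-fromℕ : ∀ i → InCycle p⁺ (inject₁ i) (fromℕ n) ⇔ (∃ λ u → InCycle p i u × PrecedesY u)
  inCycle⁺-fromℕ i = mk⇔
    (λ (m , eq) → let u , i↝u , u↦y = proj₂ (orbit-inject₁ (toℕ m) i) eq in u , reach⇒inCycle p i↝u , u↦y)
    (λ (u , i↝u , u↦y) → reach⇒inCycle p⁺ (reach-trans p⁺ (reach⁺-inject₁ (inCycle⇒reach p i↝u))
                                              (1 , trans (p⁺-inject₁ u) (redirect-into u↦y))))

  isCycleMin⁺-inject₁ : ∀ i → IsCycleMin p⁺ (inject₁ i) ⇔ IsCycleMin p i
  isCycleMin⁺-inject₁ i = mk⇔ to from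
    where
    to : IsCycleMin p⁺ (inject₁ i) → IsCycleMin p i
    to min j i↝j = subst₂ _≤_ (FinP.toℕ-inject₁ i) (FinP.toℕ-inject₁ j)
                     (min (inject₁ j) (Equivalence.from (inCycle⁺-inject₁ i j) i↝j))
    from : IsCycleMin p i → IsCycleMin p⁺ (inject₁ i)
    from min j i↝j with inject₁⊎fromℕ j
    ... | inj₁ (j′ , refl) = subst₂ _≤_ (sym (FinP.toℕ-inject₁ i)) (sym (FinP.toℕ-inject₁ j′))
                               (min j′ (Equivalence.to (inCycle⁺-inject₁ i j′) i↝j))
    ... | inj₂ refl        = subst₂ _≤_ (sym (FinP.toℕ-inject₁ i)) (sym (FinP.toℕ-fromℕ n)) (ℕP.<⇒≤ (FinP.toℕ<n i))

  fromℕ-fixed : y ≡ fromℕ n → ∀ m → iter p⁺ m (fromℕ n) ≡ fromℕ n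
  fromℕ-fixed y≡n zero    = refl
  fromℕ-fixed y≡n (suc m) = trans (cong (lookup p⁺) (fromℕ-fixed y≡n m)) (trans p⁺-fromℕ y≡n)

  isCycleMin⁺-fromℕ : IsCycleMin p⁺ (fromℕ n) ⇔ y ≡ fromℕ n
  isCycleMin⁺-fromℕ = mk⇔ to from
    where
    to : IsCycleMin p⁺ (fromℕ n) → y ≡ fromℕ n
    to min = FinP.toℕ-injective (trans (ℕP.≤-antisym (ℕP.<⇒≤pred (FinP.toℕ<n y)) n≤y) (sym (FinP.toℕ-fromℕ n)))
      where
      n≤y : n ≤ toℕ y
      n≤y = subst (_≤ toℕ y) (FinP.toℕ-fromℕ n) (min y (reach⇒inCycle p⁺ (1 , p⁺-fromℕ)))
    from : y ≡ fromℕ n → IsCycleMin p⁺ (fromℕ n)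
    from y≡n j (m , eq) = ℕP.≤-reflexive (cong toℕ (trans (sym (fromℕ-fixed y≡n (toℕ m))) eq))

isPerm⇒surjective : ∀ {n} {p : Vec (Fin n) n} → IsPerm p → ∀ j → ∃ λ i → lookup p i ≡ j
isPerm⇒surjective {suc n} {p} perm j with FinP.any? (λ i → lookup p i FinP.≟ j)
... | yes hit  = hit
... | no  miss = ⊥-elim (collision (λ i eq → miss (i , sym eq)))
  where
  -- otherwise p would map Fin (suc n) injectively into Fin n
  collision : (∀ i → j ≢ lookup p i) → ⊥
  collision j≢ with FinP.pigeonhole (ℕP.n<1+n n) (λ i → punchOut (j≢ i))
  ... | i₁ , i₂ , i₁<i₂ , same =
    ℕP.<⇒≢ i₁<i₂ (cong toℕ (UniqueP.lookup-injective perm i₁ i₂ (FinP.punchOut-injective (j≢ i₁) (j≢ i₂) same)))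

punchIn-mono-< : ∀ {n} (x : Fin (suc n)) {j k : Fin n} → toℕ j < toℕ k → toℕ (punchIn x j) < toℕ (punchIn x k)
punchIn-mono-< x {j} {k} j<k = ℕP.≤∧≢⇒< (FinP.punchIn-mono-≤ x j k (ℕP.<⇒≤ j<k))
  (λ eq → ℕP.<⇒≢ j<k (cong toℕ (FinP.punchIn-injective x j k (FinP.toℕ-injective eq))))

punchIn-cancel-< : ∀ {n} (x : Fin (suc n)) {j k : Fin n} → toℕ (punchIn x j) < toℕ (punchIn x k) → toℕ j < toℕ k
punchIn-cancel-< x {j} {k} lt = ℕP.≰⇒> (λ k≤j → ℕP.<⇒≱ lt (FinP.punchIn-mono-≤ x k j k≤j))

-- If x > 0 then the value 0 comes after position 0.
isRLMin-prepend-zero⇒ : ∀ {n} (x : Fin (suc n)) {p : Vec (Fin n) n} → IsPerm p →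
                        IsRLMin (prepend x p) Fin.zero → x ≡ Fin.zero
isRLMin-prepend-zero⇒ Fin.zero            _    _   = refl
isRLMin-prepend-zero⇒ {suc n} x@(Fin.suc _) {p} perm min =
  let i , pᵢ≡0 = isPerm⇒surjective perm Fin.zero
      xᵢ≡0 = trans (lookup-map i (punchIn x) p) (cong (punchIn x) pᵢ≡0)
  in ⊥-elim (ℕP.n≮0 (subst (λ v → toℕ x < toℕ v) xᵢ≡0 (min (Fin.suc i) (s≤s z≤n))))

module RLMinimaOfPrepend {n} (x : Fin (suc n)) (p : Vec (Fin n) n) where

  lookup-prepend : ∀ j → lookup (prepend x p) (Fin.suc j) ≡ punchIn x (lookup p j)
  lookup-prepend j = lookup-map j (punchIn x) p

  isRLMin-suc : ∀ i → IsRLMin (prepend x p) (Fin.suc i) ⇔ IsRLMin p i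
  isRLMin-suc i = mk⇔
    (λ min j i<j → punchIn-cancel-< x (subst₂ (λ u v → toℕ u < toℕ v) (lookup-prepend i) (lookup-prepend j) (min (Fin.suc j) (s≤s i<j))))
    (λ { min Fin.zero () ; min (Fin.suc j) (s≤s i<j) →
         subst₂ (λ u v → toℕ u < toℕ v) (sym (lookup-prepend i)) (sym (lookup-prepend j)) (punchIn-mono-< x (min j i<j)) })

  isRLMin-zero : IsPerm p → IsRLMin (prepend x p) Fin.zero ⇔ x ≡ Fin.zero
  isRLMin-zero perm = mk⇔ (isRLMin-prepend-zero⇒ x perm) (λ { refl → from })
    where
    from : IsRLMin (prepend Fin.zero p) Fin.zero
    from Fin.zero    ()
    from (Fin.suc j) _ = subst (λ v → 0 < toℕ v) (sym (lookup-map j (punchIn Fin.zero) p)) (s≤s z≤n)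

lRLMin-prepend : ∀ {a n} (L : Subset a) (x : Fin (suc n)) (t : Fin a) {p : Vec (Fin n) n} (c : Vec (Fin a) n) →
                 IsPerm p → lRLMin L (prepend x p , t ∷ c) ≡ 𝟙 ((x FinP.≟ Fin.zero) ×-dec (t ∈? L)) + lRLMin L (p , c)
lRLMin-prepend {n = n} L x t {p} c perm =
  trans (countFin≡∑𝟙 (suc n) minL?)
        (cong₂ _+_ (𝟙-cong (isRLMin-zero perm ×-⇔ ⇔-id _) (minL? Fin.zero) ((x FinP.≟ Fin.zero) ×-dec (t ∈? L)))
                   (trans (sum-cong-≗ (λ i → 𝟙-cong (isRLMin-suc i ×-⇔ ⇔-id _) (minL? (Fin.suc i)) (minL′? i)))
                          (sym (countFin≡∑𝟙 n minL′?))))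
  where
  open RLMinimaOfPrepend x p
  minL? : ∀ i → Dec (IsRLMin (prepend x p) i × lookup (t ∷ c) i ∈ L)
  minL? i = isRLMin? (prepend x p) i ×-dec (lookup (t ∷ c) i ∈? L)
  minL′? : ∀ i → Dec (IsRLMin p i × lookup c i ∈ L)
  minL′? i = isRLMin? p i ×-dec (lookup c i ∈? L)

infix 4 _≡_[mod_]
_≡_[mod_] : ℕ → ℕ → (a : ℕ) .{{_ : NonZero a}} → Set
x ≡ y [mod a ] = x % a ≡ y % a

module _ {a} .{{_ : NonZero a}} where

  %-≡mod : ∀ x → x % a ≡ x [mod a ]
  %-≡mod x = m%n%n≡m%n x a

  +-cong-mod : ∀ {x x′ y y′} → x ≡ x′ [mod a ] → y ≡ y′ [mod a ] → x + y ≡ x′ + y′ [mod a ]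
  +-cong-mod {x} {x′} {y} {y′} x≡x′ y≡y′ =
    trans (%-distribˡ-+ x y a) (trans (cong₂ (λ u v → (u + v) % a) x≡x′ y≡y′) (sym (%-distribˡ-+ x′ y′ a)))

  *-congˡ-mod : ∀ k {x y} → x ≡ y [mod a ] → k * x ≡ k * y [mod a ]
  *-congˡ-mod k {x} {y} x≡y =
    trans (%-distribˡ-* k x a) (trans (cong (λ u → (k % a * u) % a) x≡y) (sym (%-distribˡ-* k y a)))

  sum-cong-mod : ∀ {n} {f g : Fin n → ℕ} → (∀ i → f i ≡ g i [mod a ]) → sum f ≡ sum g [mod a ]
  sum-cong-mod {zero}  f≡g = refl
  sum-cong-mod {suc n} f≡g = +-cong-mod (f≡g Fin.zero) (sum-cong-mod (f≡g ∘ Fin.suc))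

  shift : Fin a → Fin a → Fin a
  shift t x = (toℕ x + toℕ t) mod a

  toℕ-shift : ∀ t x → toℕ (shift t x) ≡ (toℕ x + toℕ t) % a
  toℕ-shift t x = FinP.toℕ-fromℕ< (m%n<n (toℕ x + toℕ t) a)

  -- adding a ∸ t undoes the shift
  shift-injective : ∀ t {x x′} → shift t x ≡ shift t x′ → x ≡ x′
  shift-injective t {x} {x′} eq = FinP.toℕ-injective (begin
    toℕ x                                 ≡⟨ unshift x ⟨
    (toℕ (shift t x) + (a ∸ toℕ t)) % a   ≡⟨ cong (λ z → (toℕ z + (a ∸ toℕ t)) % a) eq ⟩
    (toℕ (shift t x′) + (a ∸ toℕ t)) % a  ≡⟨ unshift x′ ⟩
    toℕ x′                                ∎)
    where
    open ≡-Reasoning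
    unshift : ∀ x → (toℕ (shift t x) + (a ∸ toℕ t)) % a ≡ toℕ x
    unshift x = begin
      (toℕ (shift t x) + (a ∸ toℕ t)) % a
        ≡⟨ +-cong-mod (trans (cong (_% a) (toℕ-shift t x)) (%-≡mod _)) refl ⟩
      (toℕ x + toℕ t + (a ∸ toℕ t)) % a
        ≡⟨ cong (_% a) (ℕP.+-assoc (toℕ x) (toℕ t) _) ⟩
      (toℕ x + (toℕ t + (a ∸ toℕ t))) % a
        ≡⟨ cong (λ z → (toℕ x + z) % a) (ℕP.m+[n∸m]≡n (ℕP.<⇒≤ (FinP.toℕ<n t))) ⟩
      (toℕ x + a) % a
        ≡⟨ [m+n]%n≡m%n (toℕ x) a ⟩
      toℕ x % a
        ≡⟨ m<n⇒m%n≡m (FinP.toℕ<n x) ⟩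
      toℕ x ∎

  shiftIf : ∀ {q} {Q : Set q} → Dec Q → Fin a → Fin a → Fin a
  shiftIf (yes _) t = shift t
  shiftIf (no  _) t = id

  toℕ-shiftIf : ∀ {q} {Q : Set q} (Q? : Dec Q) t x → toℕ (shiftIf Q? t x) ≡ toℕ x + 𝟙 Q? * toℕ t [mod a ]
  toℕ-shiftIf (yes _) t x = trans (cong (_% a) (toℕ-shift t x))
                                  (trans (%-≡mod _) (cong (λ z → (toℕ x + z) % a) (sym (ℕP.+-identityʳ (toℕ t)))))
  toℕ-shiftIf (no  _) t x = cong (_% a) (sym (ℕP.+-identityʳ (toℕ x)))

  shiftIf-injective : ∀ {q} {Q : Set q} (Q? : Dec Q) t {x x′} → shiftIf Q? t x ≡ shiftIf Q? t x′ → x ≡ x′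
  shiftIf-injective (yes _) t = shift-injective t
  shiftIf-injective (no  _) t = id

sumOverCycle≡∑ : ∀ {n} (p : Vec (Fin n) n) i f → sumOverCycle p i f ≡ ∑[ j < n ] (𝟙 (inCycle? p i j) * f j)
sumOverCycle≡∑ {n} p i f = trans (sumOver-filter (inCycle? p i) (allFin n) f) (sumOver-allFin n _)

sumOverCycle-init-last : ∀ {n} (p : Vec (Fin (suc n)) (suc n)) i f → sumOverCycle p i f
  ≡ ∑[ j < n ] (𝟙 (inCycle? p i (inject₁ j)) * f (inject₁ j)) + 𝟙 (inCycle? p i (fromℕ n)) * f (fromℕ n)
sumOverCycle-init-last p i f = trans (sumOverCycle≡∑ p i f) (sum-init-last (λ j → 𝟙 (inCycle? p i j) * f j))

module ColoursOfInsertLast {a} .{{_ : NonZero a}} {n} {p : Vec (Fin n) n} (perm : IsPerm p) (y : Fin (suc n)) (t : Fin a) where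

  open CyclesOfInsertLast p y

  precedesY? : ∀ u → Dec (PrecedesY u)
  precedesY? u = inject₁ (lookup p u) FinP.≟ y

  precedesY-unique : ∀ {u v} → PrecedesY u → PrecedesY v → u ≡ v
  precedesY-unique u↦y v↦y = UniqueP.lookup-injective perm _ _ (FinP.inject₁-injective (trans u↦y (sym v↦y)))

  -- The colour t of the new point is moved onto the predecessor of y, so that
  -- every cycle keeps its colour.
  recolour : Vec (Fin a) n → Vec (Fin a) n
  recolour = mapAt (λ u → shiftIf (precedesY? u) t)

  recolour-injective : ∀ u {x x′} → shiftIf (precedesY? u) t x ≡ shiftIf (precedesY? u) t x′ → x ≡ x′
  recolour-injective u = shiftIf-injective (precedesY? u) t

  module _ (d : Vec (Fin a) n) where

    colour⁺ : Fin (suc n) → ℕ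
    colour⁺ j = toℕ (lookup (d ∷ʳ t) j)

    colourSum⁺-inject₁ : ∀ i → sumOverCycle p⁺ (inject₁ i) colour⁺
      ≡ ∑[ u < n ] (𝟙 (inCycle? p i u) * toℕ (lookup d u) + 𝟙 (inCycle? p i u ×-dec precedesY? u) * toℕ t)
    colourSum⁺-inject₁ i = begin
      sumOverCycle p⁺ (inject₁ i) colour⁺
        ≡⟨ sumOverCycle-init-last p⁺ (inject₁ i) colour⁺ ⟩
      ∑[ j < n ] (𝟙 (inCycle? p⁺ (inject₁ i) (inject₁ j)) * colour⁺ (inject₁ j))
        + 𝟙 (inCycle? p⁺ (inject₁ i) (fromℕ n)) * colour⁺ (fromℕ n)
        ≡⟨ cong₂ _+_ (sum-cong-≗ oldPoint) newPoint ⟩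
      ∑[ u < n ] (𝟙 (inCycle? p i u) * toℕ (lookup d u)) + ∑[ u < n ] 𝟙 (inCycleBefore? u) * toℕ t
        ≡⟨ cong (_ +_) (*-distribʳ-sum (toℕ t) (𝟙 ∘ inCycleBefore?)) ⟩
      ∑[ u < n ] (𝟙 (inCycle? p i u) * toℕ (lookup d u)) + ∑[ u < n ] (𝟙 (inCycleBefore? u) * toℕ t)
        ≡⟨ ∑-distrib-+ (λ u → 𝟙 (inCycle? p i u) * toℕ (lookup d u)) (λ u → 𝟙 (inCycleBefore? u) * toℕ t) ⟨
      ∑[ u < n ] (𝟙 (inCycle? p i u) * toℕ (lookup d u) + 𝟙 (inCycleBefore? u) * toℕ t) ∎
      where
      open ≡-Reasoning
      inCycleBefore? : ∀ u → Dec (InCycle p i u × PrecedesY u)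
      inCycleBefore? u = inCycle? p i u ×-dec precedesY? u
      oldPoint : ∀ j → 𝟙 (inCycle? p⁺ (inject₁ i) (inject₁ j)) * colour⁺ (inject₁ j) ≡ 𝟙 (inCycle? p i j) * toℕ (lookup d j)
      oldPoint j = cong₂ _*_ (𝟙-cong (inCycle⁺-inject₁ i j) (inCycle? p⁺ (inject₁ i) (inject₁ j)) (inCycle? p i j))
                             (cong toℕ (lookup-∷ʳ-inject₁ d t j))
      newPoint : 𝟙 (inCycle? p⁺ (inject₁ i) (fromℕ n)) * colour⁺ (fromℕ n) ≡ ∑[ u < n ] 𝟙 (inCycleBefore? u) * toℕ t
      newPoint = cong₂ _*_
        (trans (𝟙-cong (inCycle⁺-fromℕ i) (inCycle? p⁺ (inject₁ i) (fromℕ n)) (FinP.any? inCycleBefore?))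
               (sym (∑𝟙-atMostOne inCycleBefore? (λ (_ , u↦y) (_ , v↦y) → precedesY-unique u↦y v↦y) (FinP.any? inCycleBefore?))))
        (cong toℕ (lookup-∷ʳ-fromℕ d t))

    cycleColour⁺-inject₁ : ∀ i → cycleColour (p⁺ , d ∷ʳ t) (inject₁ i) ≡ cycleColour (p , recolour d) i
    cycleColour⁺-inject₁ i = begin
      sumOverCycle p⁺ (inject₁ i) colour⁺ % a
        ≡⟨ cong (_% a) (colourSum⁺-inject₁ i) ⟩
      ∑[ u < n ] (𝟙 (inCycle? p i u) * toℕ (lookup d u) + 𝟙 (inCycle? p i u ×-dec precedesY? u) * toℕ t) % a
        ≡⟨ sum-cong-mod shifted ⟨
      ∑[ u < n ] (𝟙 (inCycle? p i u) * toℕ (lookup (recolour d) u)) % a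
        ≡⟨ cong (_% a) (sumOverCycle≡∑ p i (toℕ ∘ lookup (recolour d))) ⟨
      sumOverCycle p i (toℕ ∘ lookup (recolour d)) % a ∎
      where
      open ≡-Reasoning
      shifted : ∀ u → 𝟙 (inCycle? p i u) * toℕ (lookup (recolour d) u)
                    ≡ 𝟙 (inCycle? p i u) * toℕ (lookup d u) + 𝟙 (inCycle? p i u ×-dec precedesY? u) * toℕ t [mod a ]
      shifted u = trans (cong (λ z → c * toℕ z % a) (lookup∘tabulate _ u))
                 (trans (*-congˡ-mod c (toℕ-shiftIf (precedesY? u) t (lookup d u)))
                        (cong (_% a) (begin
                          c * (toℕ (lookup d u) + q * toℕ t)
                            ≡⟨ ℕP.*-distribˡ-+ c _ _ ⟩
                          c * toℕ (lookup d u) + c * (q * toℕ t)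
                            ≡⟨ cong (c * toℕ (lookup d u) +_) (ℕP.*-assoc c q _) ⟨
                          c * toℕ (lookup d u) + c * q * toℕ t
                            ≡⟨ cong (λ z → c * toℕ (lookup d u) + z * toℕ t) (𝟙-× (inCycle? p i u) (precedesY? u)) ⟨
                          c * toℕ (lookup d u) + 𝟙 (inCycle? p i u ×-dec precedesY? u) * toℕ t ∎)))
        where
        c = 𝟙 (inCycle? p i u)
        q = 𝟙 (precedesY? u)

    cycleColour⁺-fromℕ : y ≡ fromℕ n → cycleColour (p⁺ , d ∷ʳ t) (fromℕ n) ≡ toℕ t
    cycleColour⁺-fromℕ y≡n = begin
      sumOverCycle p⁺ (fromℕ n) colour⁺ % a
        ≡⟨ cong (_% a) (sumOverCycle-init-last p⁺ (fromℕ n) colour⁺) ⟩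
      (∑[ j < n ] (𝟙 (inCycle? p⁺ (fromℕ n) (inject₁ j)) * colour⁺ (inject₁ j))
        + 𝟙 (inCycle? p⁺ (fromℕ n) (fromℕ n)) * colour⁺ (fromℕ n)) % a
        ≡⟨ cong (_% a) (cong₂ _+_ (sum-zero oldPoint) newPoint) ⟩
      toℕ t % a
        ≡⟨ m<n⇒m%n≡m (FinP.toℕ<n t) ⟩
      toℕ t ∎
      where
      open ≡-Reasoning
      oldPoint : ∀ j → 𝟙 (inCycle? p⁺ (fromℕ n) (inject₁ j)) * colour⁺ (inject₁ j) ≡ 0
      oldPoint j = cong (_* colour⁺ (inject₁ j)) (𝟙-no (inCycle? p⁺ (fromℕ n) (inject₁ j))
        (λ (m , eq) → FinP.fromℕ≢inject₁ (trans (sym (fromℕ-fixed y≡n (toℕ m))) eq)))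
      newPoint : 𝟙 (inCycle? p⁺ (fromℕ n) (fromℕ n)) * colour⁺ (fromℕ n) ≡ toℕ t
      newPoint = trans (cong (_* colour⁺ (fromℕ n)) (𝟙-yes (inCycle? p⁺ (fromℕ n) (fromℕ n)) (reach⇒inCycle p⁺ (reach-refl p⁺))))
                       (trans (ℕP.+-identityʳ _) (cong toℕ (lookup-∷ʳ-fromℕ d t)))

  lCycles-insertLast : ∀ (L : Subset a) d →
    lCycles L (p⁺ , d ∷ʳ t) ≡ 𝟙 ((y FinP.≟ fromℕ n) ×-dec (t ∈? L)) + lCycles L (p , recolour d)
  lCycles-insertLast L d = begin
    countFin (suc n) minL⁺?
      ≡⟨ trans (countFin≡∑𝟙 (suc n) minL⁺?) (sum-init-last (𝟙 ∘ minL⁺?)) ⟩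
    ∑[ i < n ] 𝟙 (minL⁺? (inject₁ i)) + 𝟙 (minL⁺? (fromℕ n))
      ≡⟨ cong₂ _+_ (sum-cong-≗ oldPoint) newPoint ⟩
    ∑[ i < n ] 𝟙 (minL? i) + 𝟙 newFixed?
      ≡⟨ ℕP.+-comm (∑[ i < n ] 𝟙 (minL? i)) _ ⟩
    𝟙 newFixed? + ∑[ i < n ] 𝟙 (minL? i)
      ≡⟨ cong (𝟙 newFixed? +_) (countFin≡∑𝟙 n minL?) ⟨
    𝟙 newFixed? + countFin n minL? ∎
    where
    open ≡-Reasoning
    minL⁺? : ∀ j → Dec (IsCycleMin p⁺ j × cycleColour (p⁺ , d ∷ʳ t) j ∈ℕ L)
    minL⁺? j = isCycleMin? p⁺ j ×-dec ∈ℕ? (cycleColour (p⁺ , d ∷ʳ t) j) L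
    minL? : ∀ i → Dec (IsCycleMin p i × cycleColour (p , recolour d) i ∈ℕ L)
    minL? i = isCycleMin? p i ×-dec ∈ℕ? (cycleColour (p , recolour d) i) L
    newFixed? : Dec (y ≡ fromℕ n × t ∈ L)
    newFixed? = (y FinP.≟ fromℕ n) ×-dec (t ∈? L)
    oldPoint : ∀ i → 𝟙 (minL⁺? (inject₁ i)) ≡ 𝟙 (minL? i)
    oldPoint i = 𝟙-cong (isCycleMin⁺-inject₁ i ×-⇔ mk⇔ (subst (_∈ℕ L) colour≡) (subst (_∈ℕ L) (sym colour≡)))
                        (minL⁺? (inject₁ i)) (minL? i)
      where colour≡ = cycleColour⁺-inject₁ d i
    newPoint : 𝟙 (minL⁺? (fromℕ n)) ≡ 𝟙 newFixed?
    newPoint = 𝟙-cong (mk⇔ to from) (minL⁺? (fromℕ n)) newFixed?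
      where
      to : IsCycleMin p⁺ (fromℕ n) × cycleColour (p⁺ , d ∷ʳ t) (fromℕ n) ∈ℕ L → y ≡ fromℕ n × t ∈ L
      to (min , x , x≡colour , x∈L) =
        let y≡n = Equivalence.to isCycleMin⁺-fromℕ min
        in y≡n , subst (_∈ L) (FinP.toℕ-injective (trans x≡colour (cycleColour⁺-fromℕ d y≡n))) x∈L
      from : y ≡ fromℕ n × t ∈ L → IsCycleMin p⁺ (fromℕ n) × cycleColour (p⁺ , d ∷ʳ t) (fromℕ n) ∈ℕ L
      from (y≡n , t∈L) = Equivalence.from isCycleMin⁺-fromℕ y≡n , t , sym (cycleColour⁺-fromℕ d y≡n) , t∈L

module _ {a} .{{_ : NonZero a}} (L : Subset a) where

  countShifted : (S : ∀ {n} → RawColPerm a n → ℕ) (n b k : ℕ) → ℕ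
  countShifted S n b k = permSum n (λ p → ∑ᵛ a n (λ c → 𝟙 (b + S (p , c) ≟ k)))

  CountRecursion : (S : ∀ {n} → RawColPerm a n → ℕ) → (∀ n → Fin (suc n)) → Set
  CountRecursion S x₀ = ∀ n b k →
    countShifted S (suc n) b k ≡ ∑[ x < suc n ] ∑[ t < a ] countShifted S n (b + 𝟙 ((x FinP.≟ x₀ n) ×-dec (t ∈? L))) k

  countShifted-unique : ∀ (S S′ : ∀ {n} → RawColPerm a n → ℕ) x₀ x₀′ → S ([] , []) ≡ S′ ([] , []) →
                        CountRecursion S x₀ → CountRecursion S′ x₀′ →
                        ∀ n b k → countShifted S n b k ≡ countShifted S′ n b k
  countShifted-unique S S′ x₀ x₀′ S≡S′ recS recS′ zero    b k = cong (λ s → 1 * 𝟙 (b + s ≟ k)) S≡S′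
  countShifted-unique S S′ x₀ x₀′ S≡S′ recS recS′ (suc n) b k = begin
    countShifted S (suc n) b k
      ≡⟨ recS n b k ⟩
    ∑[ x < suc n ] ∑[ t < a ] countShifted S n (b + 𝟙 ((x FinP.≟ x₀ n) ×-dec (t ∈? L))) k
      ≡⟨ sum-cong-≗ (λ x → sum-cong-≗ (λ t → countShifted-unique S S′ x₀ x₀′ S≡S′ recS recS′ n (b + 𝟙 ((x FinP.≟ x₀ n) ×-dec (t ∈? L))) k)) ⟩
    ∑[ x < suc n ] ∑[ t < a ] countShifted S′ n (b + 𝟙 ((x FinP.≟ x₀ n) ×-dec (t ∈? L))) k
      ≡⟨ via (x₀ n) ⟩
    ψ 1 + ∑[ _ < n ] ψ 0
      ≡⟨ via (x₀′ n) ⟨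
    ∑[ x < suc n ] ∑[ t < a ] countShifted S′ n (b + 𝟙 ((x FinP.≟ x₀′ n) ×-dec (t ∈? L))) k
      ≡⟨ recS′ n b k ⟨
    countShifted S′ (suc n) b k ∎
    where
    open ≡-Reasoning
    ψ : ℕ → ℕ
    ψ e = ∑[ t < a ] countShifted S′ n (b + e * 𝟙 (t ∈? L)) k
    via : ∀ z → ∑[ x < suc n ] ∑[ t < a ] countShifted S′ n (b + 𝟙 ((x FinP.≟ z) ×-dec (t ∈? L))) k
              ≡ ψ 1 + ∑[ _ < n ] ψ 0
    via z = trans (sum-cong-≗ λ x → sum-cong-≗ λ t → cong (λ e → countShifted S′ n (b + e) k) (𝟙-× (x FinP.≟ z) (t ∈? L)))
                  (∑-𝟙≟ n z ψ)

  private
    offset : ∀ b β {s s′} k → s ≡ β + s′ → 𝟙 (b + s ≟ k) ≡ 𝟙 (b + β + s′ ≟ k)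
    offset b β k s≡β+s′ = cong (λ z → 𝟙 (z ≟ k)) (trans (cong (b +_) s≡β+s′) (sym (ℕP.+-assoc b β _)))

  lRLMin-recursion : CountRecursion (lRLMin L) (λ _ → Fin.zero)
  lRLMin-recursion n b k = begin
    permSum (suc n) (λ p → ∑ᵛ a (suc n) (λ c → 𝟙 (b + lRLMin L (p , c) ≟ k)))
      ≡⟨ permSum-prepend n (λ p → ∑ᵛ a (suc n) (λ c → 𝟙 (b + lRLMin L (p , c) ≟ k))) ⟩
    ∑[ x < suc n ] permSum n (λ p → ∑[ t < a ] ∑ᵛ a n (λ c → 𝟙 (b + lRLMin L (prepend x p , t ∷ c) ≟ k)))
      ≡⟨ sum-cong-≗ (λ x → permSum-cong n λ p perm → sum-cong-≗ λ t → ∑ᵛ-cong a n λ c → offset b (β x t) k (lRLMin-prepend L x t c perm)) ⟩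
    ∑[ x < suc n ] permSum n (λ p → ∑[ t < a ] ∑ᵛ a n (λ c → 𝟙 (b + β x t + lRLMin L (p , c) ≟ k)))
      ≡⟨ sum-cong-≗ (λ x → permSum-∑-comm n a (λ p t → ∑ᵛ a n (λ c → 𝟙 (b + β x t + lRLMin L (p , c) ≟ k)))) ⟩
    ∑[ x < suc n ] ∑[ t < a ] countShifted (lRLMin L) n (b + β x t) k ∎
    where
    open ≡-Reasoning
    β : Fin (suc n) → Fin a → ℕ
    β x t = 𝟙 ((x FinP.≟ Fin.zero) ×-dec (t ∈? L))

  lCycles-recursion : CountRecursion (lCycles L) fromℕ
  lCycles-recursion n b k = begin
    permSum (suc n) (λ p → ∑ᵛ a (suc n) (λ c → 𝟙 (b + lCycles L (p , c) ≟ k)))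
      ≡⟨ permSum-insertLast n (λ p → ∑ᵛ a (suc n) (λ c → 𝟙 (b + lCycles L (p , c) ≟ k))) ⟩
    ∑[ y < suc n ] permSum n (λ p → ∑ᵛ a (suc n) (λ c → 𝟙 (b + lCycles L (insertLast y p , c) ≟ k)))
      ≡⟨ sum-cong-≗ (λ y → permSum-cong n (splitColours y)) ⟩
    ∑[ y < suc n ] permSum n (λ p → ∑[ t < a ] ∑ᵛ a n (λ d → 𝟙 (b + β y t + lCycles L (p , d) ≟ k)))
      ≡⟨ sum-cong-≗ (λ y → permSum-∑-comm n a (λ p t → ∑ᵛ a n (λ d → 𝟙 (b + β y t + lCycles L (p , d) ≟ k)))) ⟩
    ∑[ y < suc n ] ∑[ t < a ] countShifted (lCycles L) n (b + β y t) k ∎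
    where
    open ≡-Reasoning
    β : Fin (suc n) → Fin a → ℕ
    β y t = 𝟙 ((y FinP.≟ fromℕ n) ×-dec (t ∈? L))
    splitColours : ∀ y p → IsPerm p →
      ∑ᵛ a (suc n) (λ c → 𝟙 (b + lCycles L (insertLast y p , c) ≟ k))
        ≡ ∑[ t < a ] ∑ᵛ a n (λ d → 𝟙 (b + β y t + lCycles L (p , d) ≟ k))
    splitColours y p perm = begin
      ∑ᵛ a (suc n) (λ c → 𝟙 (b + lCycles L (insertLast y p , c) ≟ k))
        ≡⟨ ∑ᵛ-∷ʳ a n (λ c → 𝟙 (b + lCycles L (insertLast y p , c) ≟ k)) ⟩
      ∑ᵛ a n (λ d → ∑[ t < a ] 𝟙 (b + lCycles L (insertLast y p , d ∷ʳ t) ≟ k))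
        ≡⟨ ∑ᵛ-∑-comm a n a (λ d t → 𝟙 (b + lCycles L (insertLast y p , d ∷ʳ t) ≟ k)) ⟩
      ∑[ t < a ] ∑ᵛ a n (λ d → 𝟙 (b + lCycles L (insertLast y p , d ∷ʳ t) ≟ k))
        ≡⟨ sum-cong-≗ (λ t → ∑ᵛ-cong a n λ d → offset b (β y t) k (C.lCycles-insertLast perm y t L d)) ⟩
      ∑[ t < a ] ∑ᵛ a n (λ d → 𝟙 (b + β y t + lCycles L (p , C.recolour perm y t d) ≟ k))
        ≡⟨ sum-cong-≗ (λ t → ∑ᵛ-reindex a n _ (C.recolour-injective perm y t) (λ d → 𝟙 (b + β y t + lCycles L (p , d) ≟ k))) ⟩
      ∑[ t < a ] ∑ᵛ a n (λ d → 𝟙 (b + β y t + lCycles L (p , d) ≟ k)) ∎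
      where module C = ColoursOfInsertLast

corollary5p4 : (a : ℕ) .{{_ : NonZero a}} (L : Subset a) (n k : ℕ) →
    countColPerms a n (λ σ → lRLMin L σ ≟ k) ≡ countColPerms a n (λ σ → lCycles L σ ≟ k)
corollary5p4 a L n k = begin
  countColPerms a n (λ σ → lRLMin L σ ≟ k)   ≡⟨ countColPerms≡permSum a n (λ σ → lRLMin L σ ≟ k) ⟩
  countShifted L (lRLMin L) n 0 k            ≡⟨ countShifted-unique L (lRLMin L) (lCycles L) (λ _ → Fin.zero) fromℕ refl
                                                  (lRLMin-recursion L) (lCycles-recursion L) n 0 k ⟩
  countShifted L (lCycles L) n 0 k           ≡⟨ countColPerms≡permSum a n (λ σ → lCycles L σ ≟ k) ⟨
  countColPerms a n (λ σ → lCycles L σ ≟ k)  ∎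
  where open ≡-Reasoning
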